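{- Let $\mathfrak A$ be a structure and $k\ge1$ an integer. Then $\mathfrak A^{\mathrm{per}}\cong(\mathfrak A^k)^{\mathrm{per}}$ via an isomorphism that maps $\langle a_0\cdots a_{k-1}\rangle$ to $\langle (a_0,\dots,a_{k-1})\rangle$ for all $a_0,\dots,a_{k-1}\in A$.
   Context: A function $\vec a:\mathbb N\to X$ is periodic if for some $k\ge1$, $\vec a(i)=\vec a(i\bmod k)$ for all $i$; for $x_0,\dots,x_{k-1}\in X$, $\langle x_0\cdots x_{k-1}\rangle$ denotes the periodic function $i\mapsto x_{i\bmod k}$. The periodic power $\mathfrak C^{\mathrm{per}}$ of a structure $\mathfrak C$ is the substructure of the direct power $\mathfrak C^{\mathbb N}$ on its periodic functions. $\mathfrak A^k$ is the $k$-th direct power with universe $A^k$; thus $\langle(a_0,\dots,a_{k-1})\rangle$ is the constant sequence with value $(a_0,\dots,a_{k-1})$. -}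

module Defs where

open import Data.Nat using (ℕ; zero; suc; _+_; _*_; _%_; NonZero)
open import Data.Nat.DivMod using (m∣n⇒o%n%m≡o%m; m%n<n)
open import Data.Nat.Divisibility using (_∣_; ∣-trans; m∣m*n; n∣m*n)
open import Data.Fin using (Fin; fromℕ<)
open import Data.Vec using (Vec; []; _∷_; lookup; tabulate; map)
open import Data.Product using (Σ; ∃-syntax; _,_; proj₁; proj₂)
open import Relation.Binary.PropositionalEquality using (_≡_; refl; sym; trans; cong; cong₂)

-- First-order signatures and structures (equality is ≡ on the carrier).
-- Arguments of operations/relations are tuples, represented as vectors.

record Signature : Set₁ where
  field
    FunSym : Set
    funAr  : FunSym → ℕ
    RelSym : Set
    relAr  : RelSym → ℕ
open Signature public

record Structure (σ : Signature) : Set₁ where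
  field
    Carrier : Set
    fun     : (f : FunSym σ) → Vec Carrier (funAr σ f) → Carrier
    rel     : (r : RelSym σ) → Vec Carrier (relAr σ r) → Set
open Structure public

Pow : ∀ {σ} → Structure σ → ℕ → Structure σ
Pow 𝔄 k = record
  { Carrier = Vec (Carrier 𝔄) k
  ; fun = λ f xs → tabulate (λ c → fun 𝔄 f (map (λ v → lookup v c) xs))
  ; rel = λ r xs → ∀ (c : Fin k) → rel 𝔄 r (map (λ v → lookup v c) xs)
  }

-- Periodic functions: a is periodic iff for some k ≥ 1 (written suc p),
-- a i ≡ a (i mod k) for all i.

IsPeriodic : {X : Set} → (ℕ → X) → Set
IsPeriodic a = ∃[ p ] (∀ i → a i ≡ a (i % suc p))

Periodic : Set → Set
Periodic X = Σ (ℕ → X) IsPeriodic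

-- Equality of elements of the periodic power is equality of functions,
-- i.e. pointwise equality (Agda has no function extensionality).
_≈ₚ_ : {X : Set} → Periodic X → Periodic X → Set
x ≈ₚ y = ∀ i → proj₁ x i ≡ proj₁ y i

at : {X : Set} → ℕ → Periodic X → X
at i x = proj₁ x i

-- Closure of the periodic functions under pointwise operations
-- (so that the periodic power is a substructure of the direct power).
refinePeriod : {Y : Set} (a : ℕ → Y) (p q : ℕ) →
               (∀ i → a i ≡ a (i % suc p)) → suc p ∣ suc q →
               ∀ i → a i ≡ a (i % suc q)
refinePeriod a p q h d i =
  trans (h i) (trans (cong a (sym (m∣n⇒o%n%m≡o%m (suc p) (suc q) i d)))
                     (sym (h (i % suc q))))

tuplePeriodic : {X : Set} {n : ℕ} (xs : Vec (Periodic X) n) →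
                IsPeriodic (λ i → map (at i) xs)
tuplePeriodic [] = 0 , λ i → refl
tuplePeriodic (x ∷ xs) with proj₂ x | tuplePeriodic xs
... | p , hp | q , hq =
  q' , λ i → cong₂ _∷_ (refinePeriod (proj₁ x) p q' hp (m∣m*n (suc q)) i)
                       (refinePeriod (λ j → map (at j) xs) q q' hq
                                     (n∣m*n (suc p)) i)
  where
  q' : ℕ
  q' = q + p * suc q

perFun : ∀ {σ} (𝔄 : Structure σ) (f : FunSym σ) →
         Vec (Periodic (Carrier 𝔄)) (funAr σ f) → Periodic (Carrier 𝔄)
perFun 𝔄 f xs =
  (λ i → fun 𝔄 f (map (at i) xs)) ,
  (proj₁ (tuplePeriodic xs) , λ i → cong (fun 𝔄 f) (proj₂ (tuplePeriodic xs) i))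

perRel : ∀ {σ} (𝔄 : Structure σ) (r : RelSym σ) →
         Vec (Periodic (Carrier 𝔄)) (relAr σ r) → Set
perRel 𝔄 r xs = ∀ (i : ℕ) → rel 𝔄 r (map (at i) xs)

record PerIso {σ : Signature} (𝔄 𝔅 : Structure σ) : Set₁ where
  field
    to         : Periodic (Carrier 𝔄) → Periodic (Carrier 𝔅)
    to-cong    : ∀ {x y} → x ≈ₚ y → to x ≈ₚ to y
    injective  : ∀ {x y} → to x ≈ₚ to y → x ≈ₚ y
    surjective : ∀ (y : Periodic (Carrier 𝔅)) → ∃[ x ] (to x ≈ₚ y)
    pres-fun   : ∀ (f : FunSym σ) (xs : Vec (Periodic (Carrier 𝔄)) (funAr σ f)) →
                 to (perFun 𝔄 f xs) ≈ₚ perFun 𝔅 f (map to xs)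
    pres-rel   : ∀ (r : RelSym σ) (xs : Vec (Periodic (Carrier 𝔄)) (relAr σ r)) →
                 perRel 𝔄 r xs → perRel 𝔅 r (map to xs)
    refl-rel   : ∀ (r : RelSym σ) (xs : Vec (Periodic (Carrier 𝔄)) (relAr σ r)) →
                 perRel 𝔅 r (map to xs) → perRel 𝔄 r xs

-- ⟨a₀ ⋯ a_{k-1}⟩ : i ↦ a_{i mod k}   (k ≥ 1, written suc m)

cyc : {X : Set} (m : ℕ) → Vec X (suc m) → Periodic X
cyc m as = seq , (m , λ i → cong (lookup as) (fromℕ<-cong _ _ (sym (m%n%n≡m%n i (suc m))) _ _))
  where
  seq : ℕ → _
  seq i = lookup as (fromℕ< (m%n<n i (suc m)))
  open import Data.Fin.Properties using (fromℕ<-cong)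
  open import Data.Nat.DivMod using (m%n%n≡m%n)

const-seq : {X : Set} → X → Periodic X
const-seq x = (λ _ → x) , (0 , λ i → refl)

-- Cut a sequence into consecutive blocks of length k: x ↦ (j ↦ (x (jk), …, x (jk + k − 1))).
-- Every index is uniquely c + jk with c < k, so this is a bijection ℕ → A onto ℕ → A^k
-- under which coordinate c of entry j is entry c + jk; hence operations and relations,
-- being pointwise, correspond. A period p of x is a period of its blocking, and a period q
-- of y gives the period qk of its unblocking. The sequence ⟨a₀ ⋯ a_{k−1}⟩ is the
-- unblocking of the constant sequence ⟨(a₀, …, a_{k−1})⟩.
module Submission where

open import Defs
open import Data.Nat using (ℕ; suc; _+_; _*_; _%_; _/_; NonZero)
open import Data.Nat.DivMod
  using ( _mod_; _divMod_; module DivMod; m%n<n; m≡m%n+[m/n]*n; [m+kn]%n≡m%n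
        ; m<n⇒m%n≡m; m<n⇒m/n≡0; +-distrib-/-∣ʳ; m*n/n≡m )
open import Data.Nat.Divisibility using (divides)
open import Data.Nat.Properties using (*-assoc)
open import Data.Nat.Tactic.RingSolver using (solve-∀)
open import Data.Fin using (Fin; toℕ)
open import Data.Fin.Properties using (fromℕ<-cong; fromℕ<-toℕ; toℕ<n)
open import Data.Vec using (Vec; []; _∷_; lookup; tabulate; map)
open import Data.Vec.Properties using (tabulate-cong; tabulate∘lookup; lookup∘tabulate)
open import Data.Product using (Σ; _,_; proj₁)
open import Relation.Binary.PropositionalEquality
  using (_≡_; refl; sym; trans; cong; cong₂; subst; module ≡-Reasoning)

module _ {n : ℕ} .{{_ : NonZero n}} where

  toℕ[m-mod-n]+[m/n]*n≡m : ∀ m → toℕ (m mod n) + m / n * n ≡ m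
  toℕ[m-mod-n]+[m/n]*n≡m m = sym (DivMod.property (m divMod n))

  [m+kn]/n≡m/n+k : ∀ m k → (m + k * n) / n ≡ m / n + k
  [m+kn]/n≡m/n+k m k =
    trans (+-distrib-/-∣ʳ m (divides k refl)) (cong (m / n +_) (m*n/n≡m k n))

  [m+kn]mod-n≡m-mod-n : ∀ m k → (m + k * n) mod n ≡ m mod n
  [m+kn]mod-n≡m-mod-n m k = fromℕ<-cong _ _ ([m+kn]%n≡m%n m k n) _ _

  toℕ[i]/n≡0 : (i : Fin n) → toℕ i / n ≡ 0
  toℕ[i]/n≡0 i = m<n⇒m/n≡0 (toℕ<n i)

  toℕ[i]mod-n≡i : (i : Fin n) → toℕ i mod n ≡ i
  toℕ[i]mod-n≡i i =
    trans (fromℕ<-cong (toℕ i % n) (toℕ i) (m<n⇒m%n≡m (toℕ<n i)) (m%n<n (toℕ i) n) (toℕ<n i))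
          (fromℕ<-toℕ i (toℕ<n i))

  ShiftInvariant : {X : Set} → (ℕ → X) → Set
  ShiftInvariant a = ∀ r t → a (r + t * n) ≡ a r

  module _ {X : Set} (a : ℕ → X) where

    periodic⇒shiftInvariant : (∀ i → a i ≡ a (i % n)) → ShiftInvariant a
    periodic⇒shiftInvariant per r t =
      trans (per _) (trans (cong a ([m+kn]%n≡m%n r t n)) (sym (per r)))

    shiftInvariant⇒periodic : ShiftInvariant a → ∀ i → a i ≡ a (i % n)
    shiftInvariant⇒periodic inv i =
      trans (cong a (m≡m%n+[m/n]*n i n)) (inv (i % n) (i / n))

module Blocks {A : Set} (m : ℕ) where

  k : ℕ
  k = suc m

  block : (ℕ → A) → ℕ → Vec A k
  block x j = tabulate (λ c → x (toℕ c + j * k))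

  unblock : (ℕ → Vec A k) → ℕ → A
  unblock y i = lookup (y (i / k)) (i mod k)

  unblock-+-block : ∀ y i u → unblock y (i + u * k) ≡ lookup (y (i / k + u)) (i mod k)
  unblock-+-block y i u =
    cong₂ lookup (cong y ([m+kn]/n≡m/n+k i u)) ([m+kn]mod-n≡m-mod-n i u)

  unblock-block : ∀ x i → unblock (block x) i ≡ x i
  unblock-block x i =
    trans (lookup∘tabulate (λ c → x (toℕ c + i / k * k)) (i mod k))
          (cong x (toℕ[m-mod-n]+[m/n]*n≡m i))

  block-unblock : ∀ y j → block (unblock y) j ≡ y j
  block-unblock y j = begin
    tabulate (λ c → unblock y (toℕ c + j * k))
      ≡⟨ tabulate-cong (λ c → unblock-+-block y (toℕ c) j) ⟩
    tabulate (λ c → lookup (y (toℕ c / k + j)) (toℕ c mod k))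
      ≡⟨ tabulate-cong (λ c → cong₂ lookup (cong (λ q → y (q + j)) (toℕ[i]/n≡0 c))
                                           (toℕ[i]mod-n≡i c)) ⟩
    tabulate (lookup (y j))
      ≡⟨ tabulate∘lookup (y j) ⟩
    y j ∎
    where open ≡-Reasoning

  block-periodic : ∀ {x} → IsPeriodic x → IsPeriodic (block x)
  block-periodic {x} (p , per) = p , shiftInvariant⇒periodic (block x) λ r t →
    tabulate-cong λ c → trans (cong x (regroup (toℕ c) r t (suc p) k))
                              (periodic⇒shiftInvariant x per (toℕ c + r * k) (t * k))
    where
    regroup : ∀ c r t p k → c + (r + t * p) * k ≡ (c + r * k) + (t * k) * p
    regroup = solve-∀

  -- The period q + 1 of y becomes the period (q + 1) k = suc (m + q k) of the unblocking.
  unblock-periodic : ∀ {y} → IsPeriodic y → IsPeriodic (unblock y)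
  unblock-periodic {y} (q , per) = m + q * k , shiftInvariant⇒periodic (unblock y) λ r t → begin
    unblock y (r + t * (suc q * k))
      ≡⟨ cong (λ u → unblock y (r + u)) (sym (*-assoc t (suc q) k)) ⟩
    unblock y (r + (t * suc q) * k)
      ≡⟨ unblock-+-block y r (t * suc q) ⟩
    lookup (y (r / k + t * suc q)) (r mod k)
      ≡⟨ cong (λ v → lookup v (r mod k)) (periodic⇒shiftInvariant y per (r / k) t) ⟩
    unblock y r ∎
    where open ≡-Reasoning

module _ {σ : Signature} (𝔄 : Structure σ) (m : ℕ) where
  open Blocks {Carrier 𝔄} m

  blockₚ : Periodic (Carrier 𝔄) → Periodic (Vec (Carrier 𝔄) k)
  blockₚ (x , per) = block x , block-periodic per

  unblockₚ : Periodic (Vec (Carrier 𝔄) k) → Periodic (Carrier 𝔄)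
  unblockₚ (y , per) = unblock y , unblock-periodic per

  coordinate-blockₚ : ∀ {n} (xs : Vec (Periodic (Carrier 𝔄)) n) j (c : Fin k) →
    map (λ v → lookup v c) (map (at j) (map blockₚ xs)) ≡ map (at (toℕ c + j * k)) xs
  coordinate-blockₚ []       j c = refl
  coordinate-blockₚ (x ∷ xs) j c =
    cong₂ _∷_ (lookup∘tabulate (λ c → at (toℕ c + j * k) x) c) (coordinate-blockₚ xs j c)

  blockIso : PerIso 𝔄 (Pow 𝔄 k)
  blockIso = record
    { to         = blockₚ
    ; to-cong    = λ x≈y j → tabulate-cong λ c → x≈y (toℕ c + j * k)
    ; injective  = λ {x} {y} bx≈by i →
        trans (sym (unblock-block (proj₁ x) i))
              (trans (cong (λ v → lookup v (i mod k)) (bx≈by (i / k)))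
                     (unblock-block (proj₁ y) i))
    ; surjective = λ y → unblockₚ y , block-unblock (proj₁ y)
    ; pres-fun   = λ f xs j → tabulate-cong λ c →
        cong (fun 𝔄 f) (sym (coordinate-blockₚ xs j c))
    ; pres-rel   = λ r xs holds j c →
        subst (rel 𝔄 r) (sym (coordinate-blockₚ xs j c)) (holds _)
    ; refl-rel   = λ r xs holds i → subst (rel 𝔄 r)
        (trans (coordinate-blockₚ xs (i / k) (i mod k))
               (cong (λ l → map (at l) xs) (toℕ[m-mod-n]+[m/n]*n≡m i)))
        (holds (i / k) (i mod k))
    }

proposition4p4 : {σ : Signature} (𝔄 : Structure σ) (m : ℕ) →
    Σ (PerIso 𝔄 (Pow 𝔄 (suc m))) (λ φ →
    (as : Vec (Carrier 𝔄) (suc m)) → PerIso.to φ (cyc m as) ≈ₚ const-seq as)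
proposition4p4 𝔄 m = blockIso 𝔄 m , λ as → Blocks.block-unblock m (λ _ → as)
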